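{- Let $d,n \ge 1$ and let $s$ be an integer with $1 + \lceil d/n \rceil \le s \le d$. For any $v \in F_s$ the infection witness tree $\mathrm{IW}(v)$ is finite. Consequently, in $d$-neighbour bootstrap percolation on $[n]^d$ with $V_{(s-1)n} \cup V_{sn}$ infected, $v$ becomes infected in finite time, and hence $F_s \subseteq \langle V_{(s-1)n} \cup V_{sn} \rangle_d$.
   Context: $[n] = \{1,\dots,n\}$, $[n]^d$ is the $d$-dimensional grid (vertices adjacent iff they differ by $1$ in exactly one coordinate), and $e_j$ is the $j$-th standard unit vector. In $d$-neighbour bootstrap percolation, in each round every healthy vertex with at least $d$ infected neighbours becomes infected; $\langle B\rangle_d$ is the set of vertices eventually infected starting from $B$. For $d \le k \le dn$, $V_k = \{v \in [n]^d : \sum_{i=1}^d v_i = k\}$ (and $V_k=\emptyset$ otherwise). Set $F_s = \bigcup_{i=1}^{n-1} V_{(s-1)n+i}$. For $v \in F_s$ let $t_v = \sum_{i=1}^d v_i - (s-1)n$ and $\mathrm{Pre}(v) = \{v + e_j : v_j \le t_v\} \cup \{v - e_j : v_j > t_v\}$ (a set of $d$ vertices of $[n]^d$). The infection witness tree $\mathrm{IW}(v)$ is the directed rooted $d$-ary tree, edges directed away from the root, with vertices labelled by elements of $F_s \cup V_{(s-1)n} \cup V_{sn}$ (labels may repeat), built as follows: the root is labelled $v$ and declared active; repeatedly an active tree vertex is selected; if its label $u$ lies in $V_{(s-1)n} \cup V_{sn}$ it becomes a leaf and is made inactive; if $u \in F_s$ it is given $d$ active children labelled by the elements of $\mathrm{Pre}(u)$,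 and is made inactive. -}

module Defs where

open import Data.Nat using (ℕ; zero; suc; _+_; _*_; _∸_; _≤_; _<_; NonZero)
open import Data.Nat.DivMod using (_/_)
open import Data.Fin using (Fin)
open import Data.Vec using (Vec; lookup; sum; _[_]≔_)
open import Data.Vec.Relation.Unary.All using (All)
open import Data.Product using (Σ; ∃; _×_; _,_)
open import Data.Sum using (_⊎_)
open import Relation.Binary.PropositionalEquality using (_≡_)
open import Relation.Nullary using (¬_)
open import Function.Definitions using (Injective)

⌈_/_⌉ : ℕ → (n : ℕ) → .{{NonZero n}} → ℕ
⌈ d / n ⌉ = (d + n ∸ 1) / n

InGrid : ∀ {d} → ℕ → Vec ℕ d → Set
InGrid n v = All (λ x → 1 ≤ x × x ≤ n) v

Adjacent : ∀ {d} → ℕ → Vec ℕ d → Vec ℕ d → Set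
Adjacent {d} n u v =
  InGrid n u × InGrid n v ×
  Σ (Fin d) (λ j →
    (lookup u j ≡ suc (lookup v j) ⊎ lookup v j ≡ suc (lookup u j)) ×
    (∀ i → ¬ (i ≡ j) → lookup u i ≡ lookup v i))

V : ∀ {d} → ℕ → ℕ → Vec ℕ d → Set
V n k v = InGrid n v × sum v ≡ k

F : ∀ {d} → ℕ → ℕ → Vec ℕ d → Set
F n s v = ∃ λ i → 1 ≤ i × i ≤ n ∸ 1 × V n ((s ∸ 1) * n + i) v

t : ∀ {d} → ℕ → ℕ → Vec ℕ d → ℕ
t n s v = sum v ∸ (s ∸ 1) * n

-- Pre(v) = { v + e_j : v_j ≤ t_v } ∪ { v − e_j : v_j > t_v },
-- given as the family j ↦ (element associated with coordinate j).
pre : ∀ {d} → ℕ → ℕ → Vec ℕ d → Fin d → Vec ℕ d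
pre n s v j with lookup v j Data.Nat.≤? t n s v
... | Relation.Nullary.yes _ = v [ j ]≔ (lookup v j + 1)
... | Relation.Nullary.no  _ = v [ j ]≔ (lookup v j ∸ 1)

-- Since IW(u) is determined by its root label u, its finiteness is the
-- inductive (well-founded) unfolding of the construction: a label in
-- V_{(s-1)n} ∪ V_{sn} gives a leaf; a label in F_s gives a node whose
-- d children are the trees IW(u') for u' ∈ Pre(u), all finite.
data IWFinite {d : ℕ} (n s : ℕ) : Vec ℕ d → Set where
  leaf : ∀ {u} → V n ((s ∸ 1) * n) u ⊎ V n (s * n) u → IWFinite n s u
  node : ∀ {u} → F n s u → (∀ j → IWFinite n s (pre n s u j)) → IWFinite n s u

-- ⟨ B ⟩_d on [n]^d: vertices eventually infected in d-neighbour bootstrap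
-- percolation started from B (each derivation = finitely many rounds).
data Closure {d : ℕ} (n : ℕ) (B : Vec ℕ d → Set) : Vec ℕ d → Set where
  base : ∀ {v} → B v → Closure n B v
  step : ∀ {v} → InGrid n v → (f : Fin d → Vec ℕ d) → Injective _≡_ _≡_ f →
         (∀ j → Adjacent n v (f j)) → (∀ j → Closure n B (f j)) → Closure n B v

{-# OPTIONS --safe #-}
module Submission where

-- Each element of Pre(u) moves one coordinate of u by one and moves the level t_u by one in
-- the same direction: up when the coordinate is at most t_u, down otherwise.  In either case
-- the quantity |u|² − t_u(t_u + 1) strictly decreases, and on the levels 0 ≤ t ≤ n it is
-- bounded below by −n(n + 1), so every branch of IW(v) reaches level 0 or n after finitely
-- many steps.  The d elements of Pre(u) are distinct neighbours of u, so the same recursion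
-- is an infection derivation of v.

open import Defs
open import Data.Nat
  using (ℕ; zero; suc; _+_; _*_; _∸_; _≤_; _<_; _≤?_; _≟_; NonZero; >-nonZero; z≤n; z<s; s≤s)
open import Data.Nat.Induction using (<-wellFounded)
open import Data.Nat.Properties
open import Data.Nat.Tactic.RingSolver using (solve-∀)
open import Data.Fin as Fin using (Fin)
open import Data.Vec using (Vec; _∷_; lookup; map; sum; _[_]≔_)
open import Data.Vec.Properties using (lookup∘update; lookup∘update′; lookup-map; map-[]≔)
open import Data.Vec.Relation.Unary.All using (All; _∷_)
open import Data.Vec.Relation.Unary.All.Properties using (lookup⁺)
open import Data.Product using (_×_; _,_; proj₁; proj₂)
open import Data.Sum using (_⊎_; inj₁; inj₂)
open import Data.Empty using (⊥-elim)
open import Function.Definitions using (Injective)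
open import Induction.WellFounded using (Acc; acc)
open import Relation.Binary.PropositionalEquality
open import Relation.Nullary using (¬_; yes; no)

sumSq : ∀ {d} → Vec ℕ d → ℕ
sumSq u = sum (map (λ x → x * x) u)

sum-[]≔ : ∀ {d} (u : Vec ℕ d) j y → sum (u [ j ]≔ y) + lookup u j ≡ sum u + y
sum-[]≔ (x ∷ u) Fin.zero    y = exchange x y (sum u)
  where
  exchange : ∀ a b c → b + c + a ≡ a + c + b
  exchange = solve-∀
sum-[]≔ (x ∷ u) (Fin.suc j) y = begin
  x + sum (u [ j ]≔ y) + lookup u j   ≡⟨ +-assoc x _ _ ⟩
  x + (sum (u [ j ]≔ y) + lookup u j) ≡⟨ cong (x +_) (sum-[]≔ u j y) ⟩
  x + (sum u + y)                     ≡⟨ +-assoc x _ _ ⟨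
  x + sum u + y                       ∎
  where open ≡-Reasoning

sumSq-[]≔ : ∀ {d} (u : Vec ℕ d) j y →
  sumSq (u [ j ]≔ y) + lookup u j * lookup u j ≡ sumSq u + y * y
sumSq-[]≔ u j y = begin
  sum (map sq (u [ j ]≔ y)) + sq (lookup u j)
    ≡⟨ cong₂ _+_ (cong sum (map-[]≔ sq u j)) (sym (lookup-map j sq u)) ⟩
  sum (map sq u [ j ]≔ sq y) + lookup (map sq u) j
    ≡⟨ sum-[]≔ (map sq u) j (sq y) ⟩
  sumSq u + sq y ∎
  where
  open ≡-Reasoning
  sq : ℕ → ℕ
  sq x = x * x

All-[]≔ : ∀ {d} {P : ℕ → Set} {u : Vec ℕ d} j {y} → All P u → P y → All P (u [ j ]≔ y)
All-[]≔ Fin.zero    (_ ∷ ps) py = py ∷ ps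
All-[]≔ (Fin.suc j) (p ∷ ps) py = p ∷ All-[]≔ j ps py

UnitMove : ∀ {d} → Vec ℕ d → Fin d → Vec ℕ d → Set
UnitMove u j w =
  (lookup u j ≡ suc (lookup w j) ⊎ lookup w j ≡ suc (lookup u j)) ×
  (∀ i → ¬ (i ≡ j) → lookup u i ≡ lookup w i)

unitMove-[]≔ : ∀ {d} (u : Vec ℕ d) j {y} →
  lookup u j ≡ suc y ⊎ y ≡ suc (lookup u j) → UnitMove u j (u [ j ]≔ y)
unitMove-[]≔ u j {y} move =
  subst P (sym (lookup∘update j u y)) move , λ i i≢j → sym (lookup∘update′ i≢j u y)
  where
  P : ℕ → Set
  P z = lookup u j ≡ suc z ⊎ z ≡ suc (lookup u j)

unitMoves-injective : ∀ {d} {u : Vec ℕ d} {f : Fin d → Vec ℕ d} →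
  (∀ j → UnitMove u j (f j)) → Injective _≡_ _≡_ f
unitMoves-injective {u = u} {f} moves {j} {k} fj≡fk with j Fin.≟ k
... | yes j≡k = j≡k
... | no  j≢k = ⊥-elim (no-move (proj₁ (moves j)))
  where
  unmoved : lookup (f j) j ≡ lookup u j
  unmoved = trans (cong (λ w → lookup w j) fj≡fk) (sym (proj₂ (moves k) j j≢k))
  no-move : ¬ (lookup u j ≡ suc (lookup (f j) j) ⊎ lookup (f j) j ≡ suc (lookup u j))
  no-move (inj₁ down) = 1+n≢n (sym (trans down (cong suc unmoved)))
  no-move (inj₂ up)   = 1+n≢n (trans (sym up) unmoved)

+-<-rebalance : ∀ {a a′ b b′ g g′} → a′ + b < a + b′ → g′ + b′ ≡ g + b → a′ + g′ < a + g
+-<-rebalance {a} {a′} {b} {b′} {g} {g′} lt balance =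
  +-cancelʳ-< (b + b′) (a′ + g′) (a + g) (begin-strict
    a′ + g′ + (b + b′)   ≡⟨ regroup a′ g′ b b′ ⟩
    (a′ + b) + (g′ + b′) ≡⟨ cong ((a′ + b) +_) balance ⟩
    (a′ + b) + (g + b)   <⟨ +-monoˡ-< (g + b) lt ⟩
    (a + b′) + (g + b)   ≡⟨ regroup a g b′ b ⟨
    a + g + (b′ + b)     ≡⟨ cong ((a + g) +_) (+-comm b′ b) ⟩
    a + g + (b + b′)     ∎)
  where
  open ≤-Reasoning
  regroup : ∀ x y z w → x + y + (z + w) ≡ (x + z) + (y + w)
  regroup = solve-∀

raise-level : ∀ a m i x → a + x ≡ m + i + (x + 1) → a ≡ m + suc i
raise-level a m i x eq = +-cancelʳ-≡ x a (m + suc i) (trans eq (shift m i x))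
  where
  shift : ∀ m i x → m + i + (x + 1) ≡ m + suc i + x
  shift = solve-∀

lower-level : ∀ a m i y → a + suc y ≡ m + suc i + y → a ≡ m + i
lower-level a m i y eq = +-cancelʳ-≡ (suc y) a (m + i) (trans eq (shift m i y))
  where
  shift : ∀ m i y → m + suc i + y ≡ m + i + suc y
  shift = solve-∀

raise-descent : ∀ q q′ x i → q′ + x * x ≡ q + (x + 1) * (x + 1) → x ≤ i →
  q′ + i * suc i < q + suc i * suc (suc i)
raise-descent q q′ x i eq x≤i with m≤n⇒∃[o]m+o≡n x≤i
... | e , refl = begin-strict
  q′ + (x + e) * suc (x + e)                            ≡⟨ cong (_+ (x + e) * suc (x + e)) q′≡ ⟩
  q + (2 * x + 1) + (x + e) * suc (x + e)               <⟨ m<m+n _ z<s ⟩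
  q + (2 * x + 1) + (x + e) * suc (x + e) + suc (2 * e) ≡⟨ expand q x e ⟩
  q + suc (x + e) * suc (suc (x + e))                   ∎
  where
  open ≤-Reasoning
  square-step : ∀ q x → q + (x + 1) * (x + 1) ≡ q + (2 * x + 1) + x * x
  square-step = solve-∀
  expand : ∀ q x e →
    q + (2 * x + 1) + (x + e) * suc (x + e) + suc (2 * e) ≡ q + suc (x + e) * suc (suc (x + e))
  expand = solve-∀
  q′≡ : q′ ≡ q + (2 * x + 1)
  q′≡ = +-cancelʳ-≡ (x * x) q′ (q + (2 * x + 1)) (trans eq (square-step q x))

lower-descent : ∀ q q′ y i → q′ + suc y * suc y ≡ q + y * y → i < y →
  q′ + suc i * suc (suc i) < q + i * suc i
lower-descent q q′ y i eq i<y with m≤n⇒∃[o]m+o≡n i<y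
... | e , refl = begin-strict
  q′ + suc i * suc (suc i)                    <⟨ m<m+n _ z<s ⟩
  q′ + suc i * suc (suc i) + suc (2 * e)      ≡⟨ expand q′ i e ⟩
  q′ + (2 * suc (i + e) + 1) + i * suc i      ≡⟨ cong (_+ i * suc i) q≡ ⟨
  q + i * suc i                               ∎
  where
  open ≤-Reasoning
  square-step : ∀ q y → q + suc y * suc y ≡ q + (2 * y + 1) + y * y
  square-step = solve-∀
  expand : ∀ q i e →
    q + suc i * suc (suc i) + suc (2 * e) ≡ q + (2 * suc (i + e) + 1) + i * suc i
  expand = solve-∀
  q≡ : q ≡ q′ + (2 * suc (i + e) + 1)
  q≡ = +-cancelʳ-≡ (suc (i + e) * suc (i + e)) q (q′ + (2 * suc (i + e) + 1))
         (trans (sym eq) (square-step q′ (suc (i + e))))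

module _ (n s : ℕ) .{{_ : NonZero s}} where

  Seed : ∀ {d} → Vec ℕ d → Set
  Seed u = V n ((s ∸ 1) * n) u ⊎ V n (s * n) u

  -- |u|² − i(i + 1), shifted by n(n + 1) to be a natural number on the levels i ≤ n.
  potential : ∀ {d} → ℕ → Vec ℕ d → ℕ
  potential i u = sumSq u + (n * suc n ∸ i * suc i)

  potential-decreasing : ∀ {d} {u w : Vec ℕ d} {i i′} → i ≤ n → i′ ≤ n →
    sumSq w + i * suc i < sumSq u + i′ * suc i′ → potential i′ w < potential i u
  potential-decreasing {i = i} {i′} i≤n i′≤n descent =
    +-<-rebalance {g = n * suc n ∸ i * suc i} {g′ = n * suc n ∸ i′ * suc i′} descent
      (trans (m∸n+n≡m (bound i′≤n)) (sym (m∸n+n≡m (bound i≤n))))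
    where
    bound : ∀ {k} → k ≤ n → k * suc k ≤ n * suc n
    bound k≤n = *-mono-≤ k≤n (s≤s k≤n)

  t-level : ∀ {d} {u : Vec ℕ d} {i} → sum u ≡ (s ∸ 1) * n + i → t n s u ≡ i
  t-level {i = i} sum≡ = trans (cong (_∸ (s ∸ 1) * n) sum≡) (m+n∸m≡n ((s ∸ 1) * n) i)

  pre-raises-or-lowers : ∀ {d} (u : Vec ℕ d) j →
    (lookup u j ≤ t n s u × pre n s u j ≡ u [ j ]≔ (lookup u j + 1)) ⊎
    (t n s u < lookup u j × pre n s u j ≡ u [ j ]≔ (lookup u j ∸ 1))
  pre-raises-or-lowers u j with lookup u j ≤? t n s u
  ... | yes x≤t = inj₁ (x≤t , refl)
  ... | no  x≰t = inj₂ (≰⇒> x≰t , refl)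

  record Predecessor {d} (u : Vec ℕ d) (i : ℕ) (j : Fin d) (w : Vec ℕ d) : Set where
    field
      level   : ℕ
      level≤n : level ≤ n
      atLevel : V n ((s ∸ 1) * n + level) w
      move    : UnitMove u j w
      descent : sumSq w + i * suc i < sumSq u + level * suc level

  raised-predecessor : ∀ {d} {u : Vec ℕ d} {i} j → V n ((s ∸ 1) * n + i) u →
    lookup u j ≤ i → i < n → Predecessor u i j (u [ j ]≔ (lookup u j + 1))
  raised-predecessor {u = u} {i} j (grid , sum≡) x≤i i<n = record
    { level   = suc i
    ; level≤n = i<n
    ; atLevel = All-[]≔ j grid (m≤n+m 1 x , subst (_≤ n) (+-comm 1 x) (≤-trans (s≤s x≤i) i<n))
              , raise-level _ _ i x (trans (sum-[]≔ u j (x + 1)) (cong (_+ (x + 1)) sum≡))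
    ; move    = unitMove-[]≔ u j (inj₂ (+-comm x 1))
    ; descent = raise-descent (sumSq u) _ x i (sumSq-[]≔ u j (x + 1)) x≤i
    }
    where
    x : ℕ
    x = lookup u j

  lowered-predecessor : ∀ {d} {u : Vec ℕ d} {i y} j → V n ((s ∸ 1) * n + suc i) u →
    lookup u j ≡ suc y → i < y → Predecessor u (suc i) j (u [ j ]≔ y)
  lowered-predecessor {u = u} {i} {y} j (grid , sum≡) x≡ i<y = record
    { level   = i
    ; level≤n = ≤-trans (<⇒≤ i<y) y≤n
    ; atLevel = All-[]≔ j grid (<-≤-trans z<s i<y , y≤n)
              , lower-level _ _ i y (begin
                  sum w + suc y      ≡⟨ cong (sum w +_) x≡ ⟨
                  sum w + lookup u j ≡⟨ sum-[]≔ u j y ⟩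
                  sum u + y          ≡⟨ cong (_+ y) sum≡ ⟩
                  (s ∸ 1) * n + suc i + y ∎)
    ; move    = unitMove-[]≔ u j (inj₁ x≡)
    ; descent = lower-descent (sumSq u) (sumSq w) y i
                  (subst (λ x → sumSq w + x * x ≡ sumSq u + y * y) x≡ (sumSq-[]≔ u j y)) i<y
    }
    where
    open ≡-Reasoning
    w : Vec ℕ _
    w = u [ j ]≔ y
    y≤n : y ≤ n
    y≤n = ≤-trans (n≤1+n y) (subst (_≤ n) x≡ (proj₂ (lookup⁺ grid j)))

  pre-predecessor : ∀ {d} {u : Vec ℕ d} {i} → V n ((s ∸ 1) * n + i) u → 1 ≤ i → i < n →
    ∀ j → Predecessor u i j (pre n s u j)
  pre-predecessor {u = u} {suc i} inV (s≤s z≤n) i<n j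
    with pre-raises-or-lowers u j | t-level {u = u} (proj₂ inV)
  ... | inj₁ (x≤t , pre≡) | t≡i rewrite pre≡ =
    raised-predecessor j inV (subst (lookup u j ≤_) t≡i x≤t) i<n
  ... | inj₂ (t<x , pre≡) | t≡i rewrite pre≡ =
    lowered-predecessor j inV (sym (suc-pred (lookup u j) {{>-nonZero (<-≤-trans z<s i<x)}}))
      (∸-monoˡ-≤ 1 i<x)
    where
    i<x : suc i < lookup u j
    i<x = subst (_< lookup u j) t≡i t<x

  finite-and-infected : ∀ {d} (u : Vec ℕ d) i → V n ((s ∸ 1) * n + i) u → i ≤ n →
    Acc _<_ (potential i u) → IWFinite n s u × Closure n Seed u
  finite-and-infected u zero inV _ _ = leaf seed , base seed
    where
    seed : Seed u
    seed = inj₁ (subst (λ k → V n k u) (+-identityʳ _) inV)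
  finite-and-infected u (suc i) inV i≤n (acc smaller) with suc i ≟ n
  ... | yes i≡n = leaf seed , base seed
    where
    top : (s ∸ 1) * n + suc i ≡ s * n
    top = trans (cong ((s ∸ 1) * n +_) i≡n) (trans (+-comm _ n) (cong (_* n) (suc-pred s)))
    seed : Seed u
    seed = inj₂ (subst (λ k → V n k u) top inV)
  ... | no  i≢n =
    node (suc i , s≤s z≤n , <⇒≤pred i<n , inV) (λ j → proj₁ (predecessor-result j)) ,
    step (proj₁ inV) (pre n s u) (unitMoves-injective {u = u} (λ j → Predecessor.move (P j)))
         (λ j → proj₁ inV , proj₁ (Predecessor.atLevel (P j)) , j , Predecessor.move (P j))
         (λ j → proj₂ (predecessor-result j))
    where
    i<n : suc i < n
    i<n = ≤∧≢⇒< i≤n i≢n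
    P : ∀ j → Predecessor u (suc i) j (pre n s u j)
    P = pre-predecessor inV (s≤s z≤n) i<n
    predecessor-result : ∀ j → IWFinite n s (pre n s u j) × Closure n Seed (pre n s u j)
    predecessor-result j = finite-and-infected (pre n s u j) level atLevel level≤n
      (smaller (potential-decreasing {u = u} {pre n s u j} i≤n level≤n descent))
      where open Predecessor (P j)

  F-finite-and-infected : ∀ {d} {v : Vec ℕ d} → F n s v → IWFinite n s v × Closure n Seed v
  F-finite-and-infected {v = v} (i , _ , i≤n∸1 , inV) =
    finite-and-infected v i inV (≤-trans i≤n∸1 (m∸n≤m n 1)) (<-wellFounded _)

corollary4 : (d n : ℕ) → .{{_ : NonZero n}} → 1 ≤ d → (s : ℕ) →
    1 + ⌈ d / n ⌉ ≤ s → s ≤ d →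
    (v : Vec ℕ d) → F n s v →
    IWFinite n s v × Closure n (λ u → V n ((s ∸ 1) * n) u ⊎ V n (s * n) u) v
corollary4 d n _ (suc s′) (s≤s _) _ v = F-finite-and-infected n (suc s′)
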